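{- (Lumin's 2nd Theorem) Let $n,m,x\in\mathbb N$ and consider the underlying Jaco graphs $J^*_n(x)$ and $J^*_m(x)$. Label the vertices of the disjoint union $J^*_n(x)\cup J^*_m(x)$ as $v_1,\dots,v_n$ (the vertices of $J^*_n(x)$ in their Jaco order) and $v_{n+1},\dots,v_{n+m}$ (the vertices of $J^*_m(x)$ in their Jaco order), and let $\ell=\Delta(J^*_m(x))$. Then $$irr_t(J^*_n(x)\cup J^*_m(x)) \le 2\big(irr_t(J^*_n(x))+irr_t(J^*_m(x))\big) + \sum_{i=\ell+1}^{n}\sum_{j=n+\ell+1}^{n+m}|d(v_i)-d(v_j)| \quad\text{if } n>m,$$ and $$irr_t(J^*_n(x)\cup J^*_m(x)) = 4\,irr_t(J^*_n(x)) \quad\text{if } n=m.$$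
   Context: The infinite Jaco graph $J_\infty(x)$ is the directed graph with vertex set $\{v_i : i\in\mathbb N\}$, whose arcs are pairs $(v_i,v_j)$ with $i<j$, where $(v_i,v_j)$ is an arc if and only if $2i - d^-(v_i)\ge j$ ($d^-$ denotes in-degree). The finite Jaco graph $J_n(x)$ is the subgraph of $J_\infty(x)$ induced on $v_1,\dots,v_n$, and $J^*_n(x)$ denotes its underlying simple undirected graph. For a simple undirected graph $G$ with vertices $v_1,\dots,v_N$, the total irregularity is $irr_t(G)=\sum_{i=1}^{N-1}\sum_{j=i+1}^{N}|d(v_i)-d(v_j)|$ (and $0$ for a single vertex). $G\cup H$ denotes the disjoint union. -}

module Defs where

open import Data.Nat.Base using (ℕ; zero; suc; _+_; _*_; _∸_; _≤ᵇ_; _<ᵇ_; _⊔_; ∣_-_∣)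
open import Data.Bool.Base using (Bool; true; false; _∧_; _∨_; if_then_else_)
open import Data.List.Base using (List; []; _∷_; length; map; upTo; foldr)
open import Data.Nat.ListAction using (sum)

-- Ranges and sums over ranges (inclusive bounds; empty if a > b).

range : ℕ → ℕ → List ℕ
range a b = map (a +_) (upTo (suc b ∸ a))

sumFromTo : ℕ → ℕ → (ℕ → ℕ) → ℕ
sumFromTo a b f = sum (map f (range a b))

count : List ℕ → (ℕ → Bool) → ℕ
count xs p = sum (map (λ x → if p x then 1 else 0) xs)

-- Infinite Jaco graph J_∞(x).  Vertices v_1, v_2, ... (index i ≥ 1).
-- d⁻(v_j) = #{ i : 1 ≤ i < j , 2i - d⁻(v_i) ≥ j }.

-- cnt j ds : ds = [d⁻(v_k), d⁻(v_{k-1}), …, d⁻(v_1)] (head has index length ds);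
-- counts those i with j ≤ 2i - d⁻(v_i).
cnt : ℕ → List ℕ → ℕ
cnt j [] = 0
cnt j (d ∷ ds) = (if j ≤ᵇ (2 * suc (length ds)) ∸ d then 1 else 0) + cnt j ds

mutual
  inds : ℕ → List ℕ
  inds zero = []
  inds (suc k) = indeg (suc k) ∷ inds k

  -- in-degree of v_k in J_∞(x)  (indeg 0 is a dummy value; there is no v_0)
  indeg : ℕ → ℕ
  indeg zero = 0
  indeg (suc k) = cnt (suc k) (inds k)

arc : ℕ → ℕ → Bool
arc i j = (1 ≤ᵇ i) ∧ (i <ᵇ j) ∧ (j ≤ᵇ (2 * i) ∸ indeg i)

-- Finite simple undirected graphs on vertices v_1, …, v_size.

record SimpleGraph : Set where
  field
    size : ℕ
    adj  : ℕ → ℕ → Bool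
open SimpleGraph public

deg : SimpleGraph → ℕ → ℕ
deg G i = count (range 1 (size G)) (λ j → adj G i j)

maxDeg : SimpleGraph → ℕ
maxDeg G = foldr _⊔_ 0 (map (deg G) (range 1 (size G)))

irrt : SimpleGraph → ℕ
irrt G = sumFromTo 1 (size G ∸ 1) (λ i →
           sumFromTo (suc i) (size G) (λ j → ∣ deg G i - deg G j ∣))

_∪G_ : SimpleGraph → SimpleGraph → SimpleGraph
G ∪G H = record
  { size = size G + size H
  ; adj  = λ i j → if (i ≤ᵇ size G) ∧ (j ≤ᵇ size G) then adj G i j
                   else if (size G <ᵇ i) ∧ (size G <ᵇ j)
                        then adj H (i ∸ size G) (j ∸ size G)
                        else false
  }

-- J*_n(x): underlying simple graph of the Jaco graph J_n(x)
-- (subgraph of J_∞(x) induced on v_1..v_n, arcs made undirected).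
jacoStar : ℕ → SimpleGraph
jacoStar n = record { size = n ; adj = λ i j → arc i j ∨ arc j i }

module Submission where

open import Defs
open import Data.Nat.Base
open import Data.Nat.Properties
open import Data.Bool.Base using (Bool; true; false; _∨_; if_then_else_)
open import Data.Bool.Properties using (∨-identityʳ; T-≡)
open import Data.List.Base using ([]; _∷_; length; map; applyUpTo; foldr)
open import Data.Nat.ListAction using (sum)
open import Data.List.Membership.Propositional using (_∈_)
open import Data.List.Membership.Propositional.Properties using (∈-map⁻; ∈-upTo⁻)
open import Data.List.Relation.Unary.Any using (here; there)
open import Data.Product using (_×_; _,_)
open import Data.Nat.Tactic.RingSolver using (solve-∀)
open import Function.Base using (id; _∘_)
open import Function.Bundles using (Equivalence)
open import Relation.Binary.PropositionalEquality
open import Relation.Nullary using (Dec; yes; no; contradiction)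

-- Write d_G for the degree function of a graph G and, for functions f, g,
--   tri f a k       = Σ_{a ≤ i < j < a+k} |f i - f j|,
--   cross f g a k b l = Σ_{a ≤ i < a+k} Σ_{b ≤ j < b+l} |f i - g j|,
-- so that irr_t(G) = tri d_G 1 |G|.  Since the degrees of G ∪ H restrict to
-- d_G on the first |G| vertices and to d_H (shifted) on the rest,
--   irr_t(G ∪ H) = irr_t(G) + cross d_G d_H 1 |G| 1 |H| + irr_t(H).
-- For G = H the cross term is 2·irr_t(G), giving the case n = m.  If d_G and
-- d_H agree on the first ℓ vertices, splitting every range at ℓ shows that
-- the cross term exceeds irr_t(G) + irr_t(H) by at most the block over the
-- vertices beyond ℓ, which is the inequality for n > m.  The only property of
-- Jaco graphs needed is that agreement: from the closed form
--   d_{J*_N}(v_i) = d⁻(v_i) + min(N - i, i - d⁻(v_i))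
-- every vertex v_i with i ≤ Δ(J*_m) has degree i in J*_m and in every J*_n
-- with n ≥ m.

∑ : ℕ → ℕ → (ℕ → ℕ) → ℕ
∑ a zero f = 0
∑ a (suc k) f = f a + ∑ (suc a) k f

sumFromTo≡∑ : ∀ a b f → sumFromTo a b f ≡ ∑ a (suc b ∸ a) f
sumFromTo≡∑ a b f = go id (suc b ∸ a) a (λ t → refl)
  where
  -- upTo k unfolds to applyUpTo id k; generalising id makes the induction go through
  go : ∀ (g : ℕ → ℕ) k c → (∀ t → a + g t ≡ c + t) →
       sum (map f (map (a +_) (applyUpTo g k))) ≡ ∑ c k f
  go g zero c e = refl
  go g (suc k) c e = cong₂ _+_ (cong f (trans (e 0) (+-identityʳ c)))
                              (go (g ∘ suc) k (suc c) (λ t → trans (e (suc t)) (+-suc c t)))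

∑-split : ∀ a k l f → ∑ a (k + l) f ≡ ∑ a k f + ∑ (a + k) l f
∑-split a zero l f = cong (λ c → ∑ c l f) (sym (+-identityʳ a))
∑-split a (suc k) l f = begin
    f a + ∑ (suc a) (k + l) f                  ≡⟨ cong (f a +_) (∑-split (suc a) k l f) ⟩
    f a + (∑ (suc a) k f + ∑ (suc a + k) l f)  ≡⟨ sym (+-assoc (f a) _ _) ⟩
    ∑ a (suc k) f + ∑ (suc a + k) l f          ≡⟨ cong (λ c → ∑ a (suc k) f + ∑ c l f) (sym (+-suc a k)) ⟩
    ∑ a (suc k) f + ∑ (a + suc k) l f          ∎
  where open ≡-Reasoning

∈-range-suc : ∀ {a k i} → suc a ≤ i → i < suc a + k → (a ≤ i) × (i < a + suc k)
∈-range-suc {a} {k} {i} p q = <⇒≤ p , subst (i <_) (sym (+-suc a k)) q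

∑-cong : ∀ a k f g → (∀ i → a ≤ i → i < a + k → f i ≡ g i) → ∑ a k f ≡ ∑ a k g
∑-cong a zero f g e = refl
∑-cong a (suc k) f g e = cong₂ _+_ (e a ≤-refl (m<m+n a z<s))
  (∑-cong (suc a) k f g (λ i p q → let (p′ , q′) = ∈-range-suc p q in e i p′ q′))

∑-+ : ∀ a k f g → ∑ a k (λ i → f i + g i) ≡ ∑ a k f + ∑ a k g
∑-+ a zero f g = refl
∑-+ a (suc k) f g = trans (cong (f a + g a +_) (∑-+ (suc a) k f g)) (interchange (f a) (g a) _ _)
  where
  interchange : ∀ w x y z → w + x + (y + z) ≡ w + y + (x + z)
  interchange = solve-∀

∑-shift : ∀ c a k f → ∑ (c + a) k f ≡ ∑ a k (λ i → f (c + i))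
∑-shift c a zero f = refl
∑-shift c a (suc k) f = cong (f (c + a) +_)
  (trans (cong (λ x → ∑ x k f) (sym (+-suc c a))) (∑-shift c (suc a) k f))

∑-zero : ∀ a k f → (∀ i → a ≤ i → i < a + k → f i ≡ 0) → ∑ a k f ≡ 0
∑-zero a zero f e = refl
∑-zero a (suc k) f e = cong₂ _+_ (e a ≤-refl (m<m+n a z<s))
  (∑-zero (suc a) k f (λ i p q → let (p′ , q′) = ∈-range-suc p q in e i p′ q′))

∑-swap : ∀ a k b l (g : ℕ → ℕ → ℕ) →
  ∑ a k (λ i → ∑ b l (g i)) ≡ ∑ b l (λ j → ∑ a k (λ i → g i j))
∑-swap a zero b l g = sym (∑-zero b l (λ _ → 0) (λ _ _ _ → refl))
∑-swap a (suc k) b l g = trans (cong (∑ b l (g a) +_) (∑-swap (suc a) k b l g))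
  (sym (∑-+ b l (g a) (λ j → ∑ (suc a) k (λ i → g i j))))

∑-≤1 : ∀ a k f → (∀ i → f i ≤ 1) → ∑ a k f ≤ k
∑-≤1 a zero f e = z≤n
∑-≤1 a (suc k) f e = +-mono-≤ (e a) (∑-≤1 (suc a) k f e)

cross : (ℕ → ℕ) → (ℕ → ℕ) → ℕ → ℕ → ℕ → ℕ → ℕ
cross f g a k b l = ∑ a k (λ i → ∑ b l (λ j → ∣ f i - g j ∣))

tri : (ℕ → ℕ) → ℕ → ℕ → ℕ
tri f a k = ∑ a k (λ i → ∑ (suc i) (a + k ∸ suc i) (λ j → ∣ f i - f j ∣))

tri-step : ∀ f a k → tri f a (suc k) ≡ ∑ (suc a) k (λ j → ∣ f a - f j ∣) + tri f (suc a) k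
tri-step f a k rewrite +-suc a k | m+n∸m≡n a k = refl

cross-sym : ∀ f g a k b l → cross f g a k b l ≡ cross g f b l a k
cross-sym f g a k b l = trans (∑-swap a k b l (λ i j → ∣ f i - g j ∣))
  (∑-cong b l _ _ (λ j _ _ → ∑-cong a k _ _ (λ i _ _ → ∣-∣-comm (f i) (g j))))

cross-diag : ∀ f a k → cross f f a k a k ≡ 2 * tri f a k
cross-diag f a zero = refl
cross-diag f a (suc k) = begin
    (∣ f a - f a ∣ + R) + ∑ (suc a) k (λ i → ∣ f i - f a ∣ + ∑ (suc a) k (λ j → ∣ f i - f j ∣))
  ≡⟨ cong₂ (λ x y → (x + R) + y) (∣n-n∣≡0 (f a)) (∑-+ (suc a) k _ _) ⟩
    R + (∑ (suc a) k (λ i → ∣ f i - f a ∣) + cross f f (suc a) k (suc a) k)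
  ≡⟨ cong₂ (λ x y → R + (x + y)) (∑-cong (suc a) k _ _ (λ i _ _ → ∣-∣-comm (f i) (f a)))
                                 (cross-diag f (suc a) k) ⟩
    R + (R + 2 * tri f (suc a) k)
  ≡⟨ double R (tri f (suc a) k) ⟩
    2 * (R + tri f (suc a) k)
  ≡⟨ cong (2 *_) (sym (tri-step f a k)) ⟩
    2 * tri f a (suc k) ∎
  where
  open ≡-Reasoning
  R : ℕ
  R = ∑ (suc a) k (λ j → ∣ f a - f j ∣)
  double : ∀ x y → x + (x + 2 * y) ≡ 2 * (x + y)
  double = solve-∀

tri-split : ∀ f a k l → tri f a (k + l) ≡ tri f a k + cross f f a k (a + k) l + tri f (a + k) l
tri-split f a zero l rewrite +-identityʳ a = refl
tri-split f a (suc k) l = begin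
    tri f a (suc (k + l))
  ≡⟨ tri-step f a (k + l) ⟩
    ∑ (suc a) (k + l) F + tri f (suc a) (k + l)
  ≡⟨ cong₂ _+_ (∑-split (suc a) k l F) (tri-split f (suc a) k l) ⟩
    (∑ (suc a) k F + ∑ (suc a + k) l F) + (tri f (suc a) k + C + tri f (suc a + k) l)
  ≡⟨ regroup (∑ (suc a) k F) (∑ (suc a + k) l F) (tri f (suc a) k) C (tri f (suc a + k) l) ⟩
    (∑ (suc a) k F + tri f (suc a) k) + (∑ (suc a + k) l F + C) + tri f (suc a + k) l
  ≡⟨ cong (λ x → x + (∑ (suc a + k) l F + C) + tri f (suc a + k) l) (sym (tri-step f a k)) ⟩
    tri f a (suc k) + cross f f a (suc k) (suc a + k) l + tri f (suc a + k) l
  ≡⟨ cong (λ z → tri f a (suc k) + cross f f a (suc k) z l + tri f z l) (sym (+-suc a k)) ⟩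
    tri f a (suc k) + cross f f a (suc k) (a + suc k) l + tri f (a + suc k) l ∎
  where
  open ≡-Reasoning
  F : ℕ → ℕ
  F = λ j → ∣ f a - f j ∣
  C : ℕ
  C = cross f f (suc a) k (suc a + k) l
  regroup : ∀ p q r s t → (p + q) + (r + s + t) ≡ (p + r) + (q + s) + t
  regroup = solve-∀

tri-cong : ∀ f g a k → (∀ i → a ≤ i → i < a + k → f i ≡ g i) → tri f a k ≡ tri g a k
tri-cong f g a zero e = refl
tri-cong f g a (suc k) e = begin
    tri f a (suc k)
  ≡⟨ tri-step f a k ⟩
    ∑ (suc a) k (λ j → ∣ f a - f j ∣) + tri f (suc a) k
  ≡⟨ cong₂ _+_ (∑-cong (suc a) k _ _ (λ j p q → cong₂ ∣_-_∣ eₐ (e′ j p q)))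
               (tri-cong f g (suc a) k e′) ⟩
    ∑ (suc a) k (λ j → ∣ g a - g j ∣) + tri g (suc a) k
  ≡⟨ sym (tri-step g a k) ⟩
    tri g a (suc k) ∎
  where
  open ≡-Reasoning
  eₐ : f a ≡ g a
  eₐ = e a ≤-refl (m<m+n a z<s)
  e′ : ∀ j → suc a ≤ j → j < suc a + k → f j ≡ g j
  e′ j p q = let (p′ , q′) = ∈-range-suc p q in e j p′ q′

tri-shift : ∀ f c a k → tri f (c + a) k ≡ tri (λ i → f (c + i)) a k
tri-shift f c a zero = refl
tri-shift f c a (suc k) = begin
    tri f (c + a) (suc k)
  ≡⟨ tri-step f (c + a) k ⟩
    ∑ (suc (c + a)) k (λ j → ∣ f (c + a) - f j ∣) + tri f (suc (c + a)) k
  ≡⟨ cong (λ z → ∑ z k (λ j → ∣ f (c + a) - f j ∣) + tri f z k) (sym (+-suc c a)) ⟩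
    ∑ (c + suc a) k (λ j → ∣ f (c + a) - f j ∣) + tri f (c + suc a) k
  ≡⟨ cong₂ _+_ (∑-shift c (suc a) k _) (tri-shift f c (suc a) k) ⟩
    ∑ (suc a) k (λ j → ∣ f (c + a) - f (c + j) ∣) + tri (λ i → f (c + i)) (suc a) k
  ≡⟨ sym (tri-step (λ i → f (c + i)) a k) ⟩
    tri (λ i → f (c + i)) a (suc k) ∎
  where open ≡-Reasoning

cross-cong : ∀ f f′ g g′ a k b l → (∀ i → a ≤ i → i < a + k → f i ≡ f′ i) →
  (∀ j → b ≤ j → j < b + l → g j ≡ g′ j) → cross f g a k b l ≡ cross f′ g′ a k b l
cross-cong f f′ g g′ a k b l e₁ e₂ = ∑-cong a k _ _ (λ i p q →
  ∑-cong b l _ _ (λ j p′ q′ → cong₂ ∣_-_∣ (e₁ i p q) (e₂ j p′ q′)))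

cross-splitˡ : ∀ f g a k₁ k₂ b l →
  cross f g a (k₁ + k₂) b l ≡ cross f g a k₁ b l + cross f g (a + k₁) k₂ b l
cross-splitˡ f g a k₁ k₂ b l = ∑-split a k₁ k₂ _

cross-splitʳ : ∀ f g a k b l₁ l₂ →
  cross f g a k b (l₁ + l₂) ≡ cross f g a k b l₁ + cross f g a k (b + l₁) l₂
cross-splitʳ f g a k b l₁ l₂ = trans (∑-cong a k _ _ (λ i _ _ → ∑-split b l₁ l₂ _)) (∑-+ a k _ _)

cross-bound : ∀ f g a n m ℓ → ℓ ≤ n → ℓ ≤ m → (∀ i → a ≤ i → i < a + ℓ → f i ≡ g i) →
  cross f g a n a m ≤ tri f a n + tri g a m + cross f g (a + ℓ) (n ∸ ℓ) (a + ℓ) (m ∸ ℓ)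
cross-bound f g a n m ℓ ℓ≤n ℓ≤m agree =
  subst₂ _≤_ (sym cross-blocks) (sym (cong₂ (λ x y → x + y + C₂₂) tri-f tri-g))
    (arrange D C₁₂ C₂₁ C₂₂ R₁ R₂)
  where
  n′ : ℕ
  n′ = n ∸ ℓ
  m′ : ℕ
  m′ = m ∸ ℓ
  b : ℕ
  b = a + ℓ
  D : ℕ
  D = tri f a ℓ
  C₁₂ : ℕ
  C₁₂ = cross g g a ℓ b m′
  C₂₁ : ℕ
  C₂₁ = cross f f a ℓ b n′
  C₂₂ : ℕ
  C₂₂ = cross f g b n′ b m′
  R₁ : ℕ
  R₁ = tri f b n′
  R₂ : ℕ
  R₂ = tri g b m′
  -- Splitting all ranges at b = a + ℓ: the prefix triangle D is shared by f
  -- and g, C₁₂ and C₂₁ join the prefix to the rest, C₂₂ is the tail block.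
  agree′ : ∀ i → a ≤ i → i < a + ℓ → g i ≡ f i
  agree′ i p q = sym (agree i p q)
  cross-blocks : cross f g a n a m ≡ 2 * D + C₁₂ + C₂₁ + C₂₂
  cross-blocks = begin
      cross f g a n a m
    ≡⟨ cong₂ (λ x y → cross f g a x a y) (sym (m+[n∸m]≡n ℓ≤n)) (sym (m+[n∸m]≡n ℓ≤m)) ⟩
      cross f g a (ℓ + n′) a (ℓ + m′)
    ≡⟨ cross-splitˡ f g a ℓ n′ a (ℓ + m′) ⟩
      cross f g a ℓ a (ℓ + m′) + cross f g b n′ a (ℓ + m′)
    ≡⟨ cong₂ _+_ (cross-splitʳ f g a ℓ a ℓ m′) (cross-splitʳ f g b n′ a ℓ m′) ⟩
      (cross f g a ℓ a ℓ + cross f g a ℓ b m′) + (cross f g b n′ a ℓ + C₂₂)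
    ≡⟨ cong₂ (λ x y → x + (y + C₂₂))
         (cong₂ _+_ (trans (cross-cong f f g f a ℓ a ℓ (λ _ _ _ → refl) agree′) (cross-diag f a ℓ))
                    (cross-cong f g g g a ℓ b m′ agree (λ _ _ _ → refl)))
         (trans (cross-cong f f g f b n′ a ℓ (λ _ _ _ → refl) agree′) (cross-sym f f b n′ a ℓ)) ⟩
      (2 * D + C₁₂) + (C₂₁ + C₂₂)
    ≡⟨ sym (+-assoc (2 * D + C₁₂) C₂₁ C₂₂) ⟩
      2 * D + C₁₂ + C₂₁ + C₂₂ ∎
    where open ≡-Reasoning
  tri-f : tri f a n ≡ D + C₂₁ + R₁
  tri-f = trans (cong (tri f a) (sym (m+[n∸m]≡n ℓ≤n))) (tri-split f a ℓ n′)
  tri-g : tri g a m ≡ D + C₁₂ + R₂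
  tri-g = trans (cong (tri g a) (sym (m+[n∸m]≡n ℓ≤m)))
    (trans (tri-split g a ℓ m′) (cong (λ x → x + C₁₂ + R₂) (tri-cong g f a ℓ agree′)))
  -- cross = 2D + C₁₂ + C₂₁ + C₂₂ while tri f + tri g = 2D + C₂₁ + C₁₂ + R₁ + R₂.
  arrange : ∀ t c₁₂ c₂₁ c₂₂ r₁ r₂ →
    2 * t + c₁₂ + c₂₁ + c₂₂ ≤ (t + c₂₁ + r₁) + (t + c₁₂ + r₂) + c₂₂
  arrange t c₁₂ c₂₁ c₂₂ r₁ r₂ =
    subst (2 * t + c₁₂ + c₂₁ + c₂₂ ≤_) (regroup t c₁₂ c₂₁ c₂₂ r₁ r₂) (m≤m+n _ (r₁ + r₂))
    where
    regroup : ∀ t c₁₂ c₂₁ c₂₂ r₁ r₂ →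
      (2 * t + c₁₂ + c₂₁ + c₂₂) + (r₁ + r₂) ≡ (t + c₂₁ + r₁) + (t + c₁₂ + r₂) + c₂₂
    regroup = solve-∀

Ind : Bool → ℕ
Ind b = if b then 1 else 0

Ind≤1 : ∀ b → Ind b ≤ 1
Ind≤1 true = ≤-refl
Ind≤1 false = z≤n

≤ᵇ-true : ∀ {m n} → m ≤ n → (m ≤ᵇ n) ≡ true
≤ᵇ-true p = Equivalence.to T-≡ (≤⇒≤ᵇ p)

<ᵇ-true : ∀ {m n} → m < n → (m <ᵇ n) ≡ true
<ᵇ-true p = Equivalence.to T-≡ (<⇒<ᵇ p)

≤ᵇ-false : ∀ {m n} → n < m → (m ≤ᵇ n) ≡ false
≤ᵇ-false {m} {n} p with m ≤ᵇ n in eq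
... | false = refl
... | true = contradiction (≤ᵇ⇒≤ m n (Equivalence.from T-≡ eq)) (<⇒≱ p)

<ᵇ-false : ∀ {m n} → n ≤ m → (m <ᵇ n) ≡ false
<ᵇ-false {m} {n} p with m <ᵇ n in eq
... | false = refl
... | true = contradiction p (<⇒≱ (<ᵇ⇒< m n (Equivalence.from T-≡ eq)))

deg≡∑ : ∀ G i → deg G i ≡ ∑ 1 (size G) (λ j → Ind (adj G i j))
deg≡∑ G i = sumFromTo≡∑ 1 (size G) (λ j → Ind (adj G i j))

deg≤size : ∀ G i → deg G i ≤ size G
deg≤size G i = subst (_≤ size G) (sym (deg≡∑ G i)) (∑-≤1 1 (size G) _ (λ j → Ind≤1 _))

irrt≡tri : ∀ G → irrt G ≡ tri (deg G) 1 (size G)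
irrt≡tri G = begin
    irrt G
  ≡⟨ sumFromTo≡∑ 1 (size G ∸ 1) _ ⟩
    ∑ 1 (size G ∸ 1) (λ i → sumFromTo (suc i) (size G) (λ j → ∣ deg G i - deg G j ∣))
  ≡⟨ ∑-cong 1 (size G ∸ 1) _ F (λ i _ _ → sumFromTo≡∑ (suc i) (size G) _) ⟩
    ∑ 1 (size G ∸ 1) F
  ≡⟨ drop-last (size G) refl ⟩
    tri (deg G) 1 (size G) ∎
  where
  open ≡-Reasoning
  F : ℕ → ℕ
  F i = ∑ (suc i) (size G ∸ i) (λ j → ∣ deg G i - deg G j ∣)
  -- the row of the last vertex is empty
  drop-last : ∀ N → N ≡ size G → ∑ 1 (N ∸ 1) F ≡ ∑ 1 N F
  drop-last zero _ = refl
  drop-last (suc N) e = sym (begin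
      ∑ 1 (suc N) F              ≡⟨ cong (λ z → ∑ 1 z F) (+-comm 1 N) ⟩
      ∑ 1 (N + 1) F              ≡⟨ ∑-split 1 N 1 F ⟩
      ∑ 1 N F + (F (suc N) + 0)  ≡⟨ cong (λ z → ∑ 1 N F + (∑ (suc (suc N)) z (λ j → ∣ deg G (suc N) - deg G j ∣) + 0))
                                       (trans (cong (_∸ suc N) (sym e)) (n∸n≡0 (suc N))) ⟩
      ∑ 1 N F + 0                ≡⟨ +-identityʳ _ ⟩
      ∑ 1 N F                    ∎)

module _ (G H : SimpleGraph) where
  private
    n : ℕ
    n = size G
    m : ℕ
    m = size H

  deg-∪ˡ : ∀ i → i ≤ n → deg (G ∪G H) i ≡ deg G i
  deg-∪ˡ i i≤n = begin
      deg (G ∪G H) i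
    ≡⟨ deg≡∑ (G ∪G H) i ⟩
      ∑ 1 (n + m) h
    ≡⟨ ∑-split 1 n m h ⟩
      ∑ 1 n h + ∑ (1 + n) m h
    ≡⟨ cong₂ _+_ (∑-cong 1 n _ _ inside) (∑-zero (1 + n) m h outside) ⟩
      ∑ 1 n (λ j → Ind (adj G i j)) + 0
    ≡⟨ +-identityʳ _ ⟩
      ∑ 1 n (λ j → Ind (adj G i j))
    ≡⟨ sym (deg≡∑ G i) ⟩
      deg G i ∎
    where
    open ≡-Reasoning
    h : ℕ → ℕ
    h = λ j → Ind (adj (G ∪G H) i j)
    inside : ∀ j → 1 ≤ j → j < 1 + n → h j ≡ Ind (adj G i j)
    inside j _ j≤n rewrite ≤ᵇ-true i≤n | ≤ᵇ-true (≤-pred j≤n) = refl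
    outside : ∀ j → 1 + n ≤ j → j < 1 + n + m → h j ≡ 0
    outside j n<j _ rewrite ≤ᵇ-true i≤n | ≤ᵇ-false n<j | <ᵇ-false i≤n = refl

  deg-∪ʳ : ∀ j → 1 ≤ j → deg (G ∪G H) (n + j) ≡ deg H j
  deg-∪ʳ j 1≤j = begin
      deg (G ∪G H) (n + j)
    ≡⟨ deg≡∑ (G ∪G H) (n + j) ⟩
      ∑ 1 (n + m) h
    ≡⟨ ∑-split 1 n m h ⟩
      ∑ 1 n h + ∑ (1 + n) m h
    ≡⟨ cong₂ _+_ (∑-zero 1 n h outside) (cong (λ z → ∑ z m h) (+-comm 1 n)) ⟩
      ∑ (n + 1) m h
    ≡⟨ ∑-shift n 1 m h ⟩
      ∑ 1 m (λ t → h (n + t))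
    ≡⟨ ∑-cong 1 m _ _ inside ⟩
      ∑ 1 m (λ t → Ind (adj H j t))
    ≡⟨ sym (deg≡∑ H j) ⟩
      deg H j ∎
    where
    open ≡-Reasoning
    h : ℕ → ℕ
    h = λ t → Ind (adj (G ∪G H) (n + j) t)
    beyond : ∀ {t} → 1 ≤ t → n < n + t
    beyond {t} p = subst (_≤ n + t) (+-comm n 1) (+-monoʳ-≤ n p)
    outside : ∀ t → 1 ≤ t → t < 1 + n → h t ≡ 0
    outside t _ t≤n rewrite ≤ᵇ-false (beyond 1≤j) | <ᵇ-true (beyond 1≤j) | <ᵇ-false (≤-pred t≤n) = refl
    inside : ∀ t → 1 ≤ t → t < 1 + m → h (n + t) ≡ Ind (adj H j t)
    inside t 1≤t _ rewrite ≤ᵇ-false (beyond 1≤j) | <ᵇ-true (beyond 1≤j) | <ᵇ-true (beyond 1≤t)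
                         | m+n∸m≡n n j | m+n∸m≡n n t = refl

  irrt-∪ : irrt (G ∪G H) ≡ irrt G + cross (deg G) (deg H) 1 n 1 m + irrt H
  irrt-∪ = begin
      irrt (G ∪G H)
    ≡⟨ irrt≡tri (G ∪G H) ⟩
      tri u 1 (n + m)
    ≡⟨ tri-split u 1 n m ⟩
      tri u 1 n + cross u u 1 n (1 + n) m + tri u (1 + n) m
    ≡⟨ cong₂ _+_ (cong₂ _+_ left between) right ⟩
      irrt G + cross (deg G) (deg H) 1 n 1 m + irrt H ∎
    where
    open ≡-Reasoning
    u : ℕ → ℕ
    u = deg (G ∪G H)
    left : tri u 1 n ≡ irrt G
    left = trans (tri-cong u (deg G) 1 n (λ i _ i<1+n → deg-∪ˡ i (≤-pred i<1+n))) (sym (irrt≡tri G))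
    between : cross u u 1 n (1 + n) m ≡ cross (deg G) (deg H) 1 n 1 m
    between = ∑-cong 1 n _ _ (λ i _ i<1+n →
      trans (cong (λ z → ∑ z m (λ j → ∣ u i - u j ∣)) (+-comm 1 n))
      (trans (∑-shift n 1 m _)
             (∑-cong 1 m _ _ (λ j 1≤j _ → cong₂ ∣_-_∣ (deg-∪ˡ i (≤-pred i<1+n)) (deg-∪ʳ j 1≤j)))))
    right : tri u (1 + n) m ≡ irrt H
    right = begin
        tri u (1 + n) m                 ≡⟨ cong (λ z → tri u z m) (+-comm 1 n) ⟩
        tri u (n + 1) m                 ≡⟨ tri-shift u n 1 m ⟩
        tri (λ j → u (n + j)) 1 m       ≡⟨ tri-cong _ (deg H) 1 m (λ j 1≤j _ → deg-∪ʳ j 1≤j) ⟩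
        tri (deg H) 1 m                 ≡⟨ sym (irrt≡tri H) ⟩
        irrt H                          ∎

  tail-block : ∀ ℓ → ℓ ≤ n → ℓ ≤ m →
    sumFromTo (suc ℓ) n (λ i → sumFromTo (n + suc ℓ) (n + m) (λ j →
        ∣ deg (G ∪G H) i - deg (G ∪G H) j ∣))
      ≡ cross (deg G) (deg H) (suc ℓ) (n ∸ ℓ) (suc ℓ) (m ∸ ℓ)
  tail-block ℓ ℓ≤n ℓ≤m = trans (sumFromTo≡∑ (suc ℓ) n _) (∑-cong (suc ℓ) (n ∸ ℓ) _ _ row)
    where
    u : ℕ → ℕ
    u = deg (G ∪G H)
    length-row : suc (n + m) ∸ (n + suc ℓ) ≡ m ∸ ℓ
    length-row = trans (cong (_∸ (n + suc ℓ)) (sym (+-suc n m))) ([m+n]∸[m+o]≡n∸o n (suc m) (suc ℓ))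
    row : ∀ i → suc ℓ ≤ i → i < suc ℓ + (n ∸ ℓ) →
      sumFromTo (n + suc ℓ) (n + m) (λ j → ∣ u i - u j ∣)
        ≡ ∑ (suc ℓ) (m ∸ ℓ) (λ j → ∣ deg G i - deg H j ∣)
    row i _ i<end = begin
        sumFromTo (n + suc ℓ) (n + m) (λ j → ∣ u i - u j ∣)
      ≡⟨ sumFromTo≡∑ (n + suc ℓ) (n + m) _ ⟩
        ∑ (n + suc ℓ) (suc (n + m) ∸ (n + suc ℓ)) (λ j → ∣ u i - u j ∣)
      ≡⟨ cong (λ z → ∑ (n + suc ℓ) z (λ j → ∣ u i - u j ∣)) length-row ⟩
        ∑ (n + suc ℓ) (m ∸ ℓ) (λ j → ∣ u i - u j ∣)
      ≡⟨ ∑-shift n (suc ℓ) (m ∸ ℓ) _ ⟩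
        ∑ (suc ℓ) (m ∸ ℓ) (λ j → ∣ u i - u (n + j) ∣)
      ≡⟨ ∑-cong (suc ℓ) (m ∸ ℓ) _ _ (λ j ℓ<j _ → cong₂ ∣_-_∣ (deg-∪ˡ i i≤n) (deg-∪ʳ j (≤-trans (s≤s z≤n) ℓ<j))) ⟩
        ∑ (suc ℓ) (m ∸ ℓ) (λ j → ∣ deg G i - deg H j ∣) ∎
      where
      open ≡-Reasoning
      i≤n : i ≤ n
      i≤n = ≤-pred (subst (i <_) (cong suc (m+[n∸m]≡n ℓ≤n)) i<end)

irrt-∪-self : ∀ G → irrt (G ∪G G) ≡ 4 * irrt G
irrt-∪-self G = begin
    irrt (G ∪G G)
  ≡⟨ irrt-∪ G G ⟩
    I + cross (deg G) (deg G) 1 (size G) 1 (size G) + I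
  ≡⟨ cong (λ z → I + z + I) (trans (cross-diag (deg G) 1 (size G)) (cong (2 *_) (sym (irrt≡tri G)))) ⟩
    I + 2 * I + I
  ≡⟨ four I ⟩
    4 * I ∎
  where
  open ≡-Reasoning
  I : ℕ
  I = irrt G
  four : ∀ x → x + 2 * x + x ≡ 4 * x
  four = solve-∀

irrt-∪-bound : ∀ G H ℓ → ℓ ≤ size G → ℓ ≤ size H →
  (∀ i → 1 ≤ i → i ≤ ℓ → deg G i ≡ deg H i) →
  irrt (G ∪G H) ≤ 2 * (irrt G + irrt H)
    + sumFromTo (suc ℓ) (size G) (λ i → sumFromTo (size G + suc ℓ) (size G + size H) (λ j →
        ∣ deg (G ∪G H) i - deg (G ∪G H) j ∣))
irrt-∪-bound G H ℓ ℓ≤n ℓ≤m agree = begin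
    irrt (G ∪G H)
  ≡⟨ irrt-∪ G H ⟩
    I₁ + cross (deg G) (deg H) 1 n 1 m + I₂
  ≤⟨ +-monoˡ-≤ I₂ (+-monoʳ-≤ I₁ (cross-bound (deg G) (deg H) 1 n m ℓ ℓ≤n ℓ≤m
                                  (λ i 1≤i i<1+ℓ → agree i 1≤i (≤-pred i<1+ℓ)))) ⟩
    I₁ + (tri (deg G) 1 n + tri (deg H) 1 m + B) + I₂
  ≡⟨ cong₂ (λ x y → I₁ + (x + y + B) + I₂) (sym (irrt≡tri G)) (sym (irrt≡tri H)) ⟩
    I₁ + (I₁ + I₂ + B) + I₂
  ≡⟨ regroup I₁ I₂ B ⟩
    2 * (I₁ + I₂) + B
  ≡⟨ cong (2 * (I₁ + I₂) +_) (sym (tail-block G H ℓ ℓ≤n ℓ≤m)) ⟩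
    2 * (I₁ + I₂) + sumFromTo (suc ℓ) n (λ i → sumFromTo (n + suc ℓ) (n + m) (λ j →
        ∣ deg (G ∪G H) i - deg (G ∪G H) j ∣)) ∎
  where
  open ≤-Reasoning
  n : ℕ
  n = size G
  m : ℕ
  m = size H
  I₁ : ℕ
  I₁ = irrt G
  I₂ : ℕ
  I₂ = irrt H
  B : ℕ
  B = cross (deg G) (deg H) (suc ℓ) (n ∸ ℓ) (suc ℓ) (m ∸ ℓ)
  regroup : ∀ x y z → x + (x + y + z) + y ≡ 2 * (x + y) + z
  regroup = solve-∀

reach : ℕ → ℕ
reach i = 2 * i ∸ indeg i

reach≡ : ∀ {i e} → e ≤ i → 2 * i ∸ e ≡ i + (i ∸ e)
reach≡ {i} {e} e≤i = trans (cong (λ z → i + z ∸ e) (+-identityʳ i)) (+-∸-assoc i e≤i)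

length-inds : ∀ k → length (inds k) ≡ k
length-inds zero = refl
length-inds (suc k) = cong suc (length-inds k)

cnt≤length : ∀ j ds → cnt j ds ≤ length ds
cnt≤length j [] = z≤n
cnt≤length j (d ∷ ds) = +-mono-≤ (Ind≤1 (j ≤ᵇ _)) (cnt≤length j ds)

indeg≤ : ∀ k → indeg (suc k) ≤ k
indeg≤ k = subst (indeg (suc k) ≤_) (length-inds k) (cnt≤length (suc k) (inds k))

indeg≤self : ∀ i → indeg i ≤ i
indeg≤self zero = z≤n
indeg≤self (suc k) = m≤n⇒m≤1+n (indeg≤ k)

reach∸index : ∀ i → reach i ∸ i ≡ i ∸ indeg i
reach∸index i = trans (cong (_∸ i) (reach≡ (indeg≤self i))) (m+n∸m≡n i (i ∸ indeg i))

cnt-antitone : ∀ j ds → cnt (suc j) ds ≤ cnt j ds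
cnt-antitone j [] = z≤n
cnt-antitone j (d ∷ ds) = +-mono-≤ (Ind-antitone (2 * suc (length ds) ∸ d)) (cnt-antitone j ds)
  where
  Ind-antitone : ∀ x → Ind (suc j ≤ᵇ x) ≤ Ind (j ≤ᵇ x)
  Ind-antitone x with suc j ≤ᵇ x in eq
  ... | false = z≤n
  ... | true rewrite ≤ᵇ-true (<⇒≤ (≤ᵇ⇒≤ (suc j) x (Equivalence.from T-≡ eq))) = ≤-refl

indeg-step : ∀ k → indeg (suc k) ≤ suc (indeg k)
indeg-step zero = z≤n
indeg-step (suc k) = +-mono-≤ (Ind≤1 _) (cnt-antitone (suc k) (inds k))

indeg-+ : ∀ i t → indeg (i + t) ≤ indeg i + t
indeg-+ i zero rewrite +-identityʳ i | +-identityʳ (indeg i) = ≤-refl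
indeg-+ i (suc t) rewrite +-suc i t | +-suc (indeg i) t =
  ≤-trans (indeg-step (i + t)) (s≤s (indeg-+ i t))

cnt≡∑ : ∀ j k → cnt j (inds k) ≡ ∑ 1 k (λ i → Ind (j ≤ᵇ reach i))
cnt≡∑ j zero = refl
cnt≡∑ j (suc k) rewrite length-inds k = begin
    Ind (j ≤ᵇ reach (suc k)) + cnt j (inds k)
  ≡⟨ +-comm _ (cnt j (inds k)) ⟩
    cnt j (inds k) + Ind (j ≤ᵇ reach (suc k))
  ≡⟨ cong₂ _+_ (cnt≡∑ j k) (sym (+-identityʳ _)) ⟩
    ∑ 1 k g + ∑ (1 + k) 1 g
  ≡⟨ sym (∑-split 1 k 1 g) ⟩
    ∑ 1 (k + 1) g
  ≡⟨ cong (λ z → ∑ 1 z g) (+-comm k 1) ⟩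
    ∑ 1 (suc k) g ∎
  where
  open ≡-Reasoning
  g : ℕ → ℕ
  g = λ i → Ind (j ≤ᵇ reach i)

count-≤ : ∀ c a k → ∑ a k (λ t → Ind (t ≤ᵇ c)) ≡ k ⊓ (suc c ∸ a)
count-≤ c a zero = refl
count-≤ c a (suc k) with a ≤? c
... | yes a≤c rewrite ≤ᵇ-true a≤c | +-∸-assoc 1 a≤c = cong suc (count-≤ c (suc a) k)
... | no a≰c rewrite ≤ᵇ-false (≰⇒> a≰c) | m≤n⇒m∸n≡0 (≰⇒> a≰c) =
  trans (count-≤ c (suc a) k) (trans (cong (k ⊓_) (m≤n⇒m∸n≡0 (<⇒≤ (≰⇒> a≰c)))) (⊓-zeroʳ k))

deg-jaco-count : ∀ N k → suc k ≤ N → deg (jacoStar N) (suc k) ≡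
  indeg (suc k) + ∑ (suc (suc k)) (N ∸ suc k) (λ j → Ind (j ≤ᵇ reach (suc k)))
deg-jaco-count N k k<N = begin
    deg (jacoStar N) (suc k)
  ≡⟨ deg≡∑ (jacoStar N) (suc k) ⟩
    ∑ 1 N h
  ≡⟨ cong (λ z → ∑ 1 z h) (sym (trans (+-suc k r) (m+[n∸m]≡n k<N))) ⟩
    ∑ 1 (k + suc r) h
  ≡⟨ ∑-split 1 k (suc r) h ⟩
    ∑ 1 k h + (h (suc k) + ∑ (suc (suc k)) r h)
  ≡⟨ cong₂ (λ x y → x + (y + ∑ (suc (suc k)) r h)) predecessors no-loop ⟩
    indeg (suc k) + ∑ (suc (suc k)) r h
  ≡⟨ cong (indeg (suc k) +_) (∑-cong (suc (suc k)) r _ _ successors) ⟩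
    indeg (suc k) + ∑ (suc (suc k)) r (λ j → Ind (j ≤ᵇ reach (suc k))) ∎
  where
  open ≡-Reasoning
  h : ℕ → ℕ
  h = λ j → Ind (arc (suc k) j ∨ arc j (suc k))
  r : ℕ
  r = N ∸ suc k
  predecessors : ∑ 1 k h ≡ indeg (suc k)
  predecessors = trans (∑-cong 1 k _ _ earlier) (sym (cnt≡∑ (suc k) k))
    where
    earlier : ∀ j → 1 ≤ j → j < 1 + k → h j ≡ Ind (suc k ≤ᵇ reach j)
    earlier j 1≤j j≤k rewrite <ᵇ-false {suc k} {j} (<⇒≤ j≤k) | ≤ᵇ-true 1≤j | <ᵇ-true {j} {suc k} j≤k = refl
  no-loop : h (suc k) ≡ 0
  no-loop rewrite <ᵇ-false {k} {k} ≤-refl = refl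
  successors : ∀ j → suc (suc k) ≤ j → j < suc (suc k) + r → h j ≡ Ind (j ≤ᵇ reach (suc k))
  successors j k<j _ rewrite <ᵇ-true {suc k} {j} k<j | ≤ᵇ-true {1} {j} (≤-trans (s≤s z≤n) k<j)
                           | <ᵇ-false {j} {suc k} (<⇒≤ k<j) = cong Ind (∨-identityʳ _)

deg-jaco : ∀ N k → suc k ≤ N → deg (jacoStar N) (suc k) ≡
  indeg (suc k) + (N ∸ suc k) ⊓ (suc k ∸ indeg (suc k))
deg-jaco N k k<N = trans (deg-jaco-count N k k<N) (cong (indeg (suc k) +_)
  (trans (count-≤ (reach (suc k)) (suc (suc k)) (N ∸ suc k))
         (cong ((N ∸ suc k) ⊓_) (reach∸index (suc k)))))

deg-saturated : ∀ N k → suc k ≤ N → reach (suc k) ≤ N → deg (jacoStar N) (suc k) ≡ suc k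
deg-saturated N k k<N reach≤N = trans (deg-jaco N k k<N)
  (trans (cong (e +_) (m≥n⇒m⊓n≡n room)) (m+[n∸m]≡n (indeg≤self i)))
  where
  i : ℕ
  i = suc k
  e : ℕ
  e = indeg i
  room : i ∸ e ≤ N ∸ i
  room = subst (_≤ N ∸ i) (reach∸index i) (∸-monoˡ-≤ i reach≤N)

deg≤index : ∀ N k → suc k ≤ N → deg (jacoStar N) (suc k) ≤ suc k
deg≤index N k k<N = subst (_≤ suc k) (sym (deg-jaco N k k<N))
  (subst (indeg (suc k) + (N ∸ suc k) ⊓ (suc k ∸ indeg (suc k)) ≤_) (m+[n∸m]≡n (indeg≤self (suc k)))
    (+-monoʳ-≤ (indeg (suc k)) (m⊓n≤n (N ∸ suc k) _)))

deg≤remaining : ∀ N k → suc k ≤ N → deg (jacoStar N) (suc k) ≤ indeg (suc k) + (N ∸ suc k)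
deg≤remaining N k k<N = subst (_≤ indeg (suc k) + (N ∸ suc k)) (sym (deg-jaco N k k<N))
  (+-monoʳ-≤ (indeg (suc k)) (m⊓n≤m (N ∸ suc k) _))

short-of-reach : ∀ {i e u} → e ≤ i → i + u < 2 * i ∸ e → e + u < i
short-of-reach {i} {e} {u} e≤i bound =
  subst (e + u <_) (m+[n∸m]≡n e≤i)
    (+-monoʳ-< e (+-cancelˡ-< i u (i ∸ e) (subst (i + u <_) (reach≡ e≤i) bound)))

-- If the reach of v_i lies beyond J*_m, then every vertex of J*_m has degree
-- less than i: earlier vertices have degree at most their index, and a later
-- vertex v_{i+t} has at most d⁻(v_i) + t predecessors and m - i - t successors.
all-deg<index : ∀ m k → suc k ≤ m → m < reach (suc k) →
  ∀ j → 1 ≤ j → j ≤ m → deg (jacoStar m) j < suc k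
all-deg<index m k k<m m<reach (suc j) _ j<m with suc j ≤? k
... | yes j<k = ≤-<-trans (deg≤index m j j<m) (s≤s j<k)
... | no j≮k = ≤-<-trans (deg≤remaining m j j<m) (≤-<-trans bound (short-of-reach (indeg≤self i) m<reach′))
  where
  i : ℕ
  i = suc k
  t : ℕ
  t = suc j ∸ i
  s : ℕ
  s = m ∸ suc j
  j≡i+t : i + t ≡ suc j
  j≡i+t = m+[n∸m]≡n (≰⇒> j≮k)
  m≡i+t+s : i + (t + s) ≡ m
  m≡i+t+s = trans (sym (+-assoc i t s)) (trans (cong (_+ s) j≡i+t) (m+[n∸m]≡n j<m))
  m<reach′ : i + (t + s) < reach i
  m<reach′ = subst (_< reach i) (sym m≡i+t+s) m<reach
  bound : indeg (suc j) + s ≤ indeg i + (t + s)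
  bound = subst (indeg (suc j) + s ≤_) (+-assoc (indeg i) t s)
    (+-monoˡ-≤ s (subst (λ z → indeg z ≤ indeg i + t) j≡i+t (indeg-+ i t)))

maxDeg≤ : ∀ G b → (∀ j → 1 ≤ j → j ≤ size G → deg G j ≤ b) → maxDeg G ≤ b
maxDeg≤ G b bounded =
  fold≤ (range 1 (size G)) (λ x x∈ → let (1≤x , x≤N) = in-range x x∈ in bounded x 1≤x x≤N)
  where
  in-range : ∀ x → x ∈ range 1 (size G) → (1 ≤ x) × (x ≤ size G)
  in-range x x∈ with ∈-map⁻ (1 +_) x∈
  ... | y , y∈ , refl = s≤s z≤n , ∈-upTo⁻ y∈
  fold≤ : ∀ xs → (∀ x → x ∈ xs → deg G x ≤ b) → foldr _⊔_ 0 (map (deg G) xs) ≤ b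
  fold≤ [] _ = z≤n
  fold≤ (x ∷ xs) p = ⊔-lub (p x (here refl)) (fold≤ xs (λ y y∈ → p y (there y∈)))

Δ≤size : ∀ G → maxDeg G ≤ size G
Δ≤size G = maxDeg≤ G (size G) (λ j _ _ → deg≤size G j)

-- Every vertex v_i with 1 ≤ i ≤ Δ(J*_m) has its reach inside J*_m, hence
-- degree i in J*_m and in every larger J*_n.
deg-below-Δ : ∀ n m i → m ≤ n → 1 ≤ i → i ≤ maxDeg (jacoStar m) →
  deg (jacoStar n) i ≡ deg (jacoStar m) i
deg-below-Δ n m (suc k) m≤n _ i≤Δ = by-reach (reach (suc k) ≤? m)
  where
  i≤m : suc k ≤ m
  i≤m = ≤-trans i≤Δ (Δ≤size (jacoStar m))
  by-reach : Dec (reach (suc k) ≤ m) → deg (jacoStar n) (suc k) ≡ deg (jacoStar m) (suc k)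
  by-reach (yes reach≤m) = trans (deg-saturated n k (≤-trans i≤m m≤n) (≤-trans reach≤m m≤n))
                                 (sym (deg-saturated m k i≤m reach≤m))
  by-reach (no reach≰m) = contradiction i≤Δ (<⇒≱ (s≤s (maxDeg≤ (jacoStar m) k (λ j 1≤j j≤m →
    ≤-pred (all-deg<index m k i≤m (≰⇒> reach≰m) j 1≤j j≤m)))))

theorem2p2 : (n m : ℕ) → 1 ≤ n → 1 ≤ m →
    (m < n →
      irrt (jacoStar n ∪G jacoStar m)
        ≤ 2 * (irrt (jacoStar n) + irrt (jacoStar m))
          + sumFromTo (suc (maxDeg (jacoStar m))) n (λ i →
              sumFromTo (n + suc (maxDeg (jacoStar m))) (n + m) (λ j →
                ∣ deg (jacoStar n ∪G jacoStar m) i - deg (jacoStar n ∪G jacoStar m) j ∣)))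
    × (n ≡ m → irrt (jacoStar n ∪G jacoStar m) ≡ 4 * irrt (jacoStar n))
theorem2p2 n m _ _ =
    (λ m<n → irrt-∪-bound (jacoStar n) (jacoStar m) Δ (≤-trans Δ≤m (<⇒≤ m<n)) Δ≤m
               (λ i 1≤i i≤Δ → deg-below-Δ n m i (<⇒≤ m<n) 1≤i i≤Δ))
  , λ { refl → irrt-∪-self (jacoStar n) }
  where
  Δ : ℕ
  Δ = maxDeg (jacoStar m)
  Δ≤m : Δ ≤ m
  Δ≤m = Δ≤size (jacoStar m)
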